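{- For any integers $n$ and $k$ such that $n\ge 2$ and $2\le k\le 2^{n-1}+1$, we have $$v_2(s(2^n,2^n-k))=\begin{cases} n-1-v_2(k) & \text{if } 2\mid k,\\ 2n-2-v_2(k-1) & \text{if } 2\nmid k.\end{cases}$$
   Context: For nonnegative integers $n,k$, the (unsigned) Stirling number of the first kind $s(n,k)$ is defined by $x(x+1)\cdots(x+n-1)=\sum_{k=0}^{n}s(n,k)x^k$, with $s(n,k)=0$ for $k>n$. $v_2$ denotes the 2-adic valuation. -}

module Defs where

open import Data.Nat using (ℕ; zero; suc; _+_; _*_; _^_)
open import Data.Nat.Divisibility using (_∣_)
open import Data.List using (List; []; _∷_)
open import Relation.Nullary using (¬_)
open import Data.Product using (_×_)

-- Polynomials with natural-number coefficients, as coefficient lists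
-- (lowest degree first).  Coefficients beyond the list are 0.
Poly : Set
Poly = List ℕ

addP : Poly → Poly → Poly
addP [] q = q
addP (a ∷ p) [] = a ∷ p
addP (a ∷ p) (b ∷ q) = (a + b) ∷ addP p q

scaleP : ℕ → Poly → Poly
scaleP c [] = []
scaleP c (a ∷ p) = c * a ∷ scaleP c p

mulXplus : ℕ → Poly → Poly
mulXplus c p = addP (0 ∷ p) (scaleP c p)

rising : ℕ → Poly
rising zero = 1 ∷ []
rising (suc n) = mulXplus n (rising n)

coeff : Poly → ℕ → ℕ
coeff [] k = 0
coeff (a ∷ p) zero = a
coeff (a ∷ p) (suc k) = coeff p k

-- unsigned Stirling numbers of the first kind:
-- x(x+1)...(x+n-1) = Σ_k s(n,k) x^k
stirling1 : ℕ → ℕ → ℕ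
stirling1 n k = coeff (rising n) k

-- "v_2(m) = e" : 2^e divides m but 2^(e+1) does not
-- (for m ≠ 0 this determines e uniquely; for m = 0 it is never true)
V2≡ : ℕ → ℕ → Set
V2≡ m e = (2 ^ e ∣ m) × ¬ (2 ^ suc e ∣ m)

module Submission where

-- Write N = 2^n = 2M with M = 2^(n-1), and read s(N, N-k) as the coefficient of t^k in
-- the reversed rising factorial  ∏_{j<N} (1 + j t).  Pairing the factor j with 2M - j gives
--   ∏_{j<N} (1 + j t) = (1 + M t) ∏_{y=1}^{M-1} (1 + 2M t + (M² - y²) t²),
-- and modulo M² the last product is governed by  G(u) = ∏_{y=1}^{M-1} (1 - y² u):
-- its coefficient of t^(2i) is ≡ G_i and that of t^(2i+1) is ≡ 2(M-1-i) M G_i.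
-- Hence  s(N, N-2i) ≡ G_i  and  s(N, N-2i-1) ≡ M (2(M-1-i) + 1) G_i  (mod M²).
-- By repeated squaring,  ∏_{a<2^(r+1)} (1 - a² u) ≡ (1 - u)^(2^r)  (mod 2^(r+1)),
-- so G_i ≡ ± C(M/2, i) (mod M), whose 2-adic valuation is n - 2 - v₂(i) (Kummer).

open import Defs

module Valuation where

  open import Data.Nat
  open import Data.Nat.Properties
  open import Data.Nat.Divisibility
  open import Data.Nat.Induction using (<-rec)
  open import Data.Nat.Tactic.RingSolver using (solve-∀)
  open import Data.Product using (∃; ∃₂; _×_; _,_)
  open import Data.Sum using (_⊎_; inj₁; inj₂)
  open import Relation.Nullary using (¬_; contradiction)
  open import Relation.Binary.PropositionalEquality

  Odd : ℕ → Set
  Odd w = ¬ 2 ∣ w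

  double-or-odd : ∀ n → (∃ λ u → n ≡ u + u) ⊎ (∃ λ u → n ≡ suc (u + u))
  double-or-odd zero = inj₁ (0 , refl)
  double-or-odd (suc n) with double-or-odd n
  ... | inj₁ (u , n≡u+u) = inj₂ (u , cong suc n≡u+u)
  ... | inj₂ (u , n≡1+u+u) = inj₁ (suc u , cong suc (trans n≡1+u+u (sym (+-suc u u))))

  2∣double : ∀ u → 2 ∣ u + u
  2∣double u = divides u (double≡ u)
    where
    double≡ : ∀ u → u + u ≡ u * 2
    double≡ = solve-∀

  odd-double+1 : ∀ u → Odd (suc (u + u))
  odd-double+1 u 2∣ = contradiction (∣1⇒≡1 (∣m+n∣m⇒∣n (subst (2 ∣_) (+-comm 1 (u + u)) 2∣) (2∣double u))) λ ()

  odd⇒double+1 : ∀ w → Odd w → ∃ λ u → w ≡ suc (u + u)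
  odd⇒double+1 w odd with double-or-odd w
  ... | inj₁ (u , refl) = contradiction (2∣double u) odd
  ... | inj₂ w≡1+u+u = w≡1+u+u

  odd-2∣* : ∀ w b → Odd w → 2 ∣ w * b → 2 ∣ b
  odd-2∣* w b odd 2∣wb with odd⇒double+1 w odd
  ... | u , refl = ∣m+n∣m⇒∣n (subst (2 ∣_) (expand u b) 2∣wb) (∣m⇒∣m*n b (2∣double u))
    where
    expand : ∀ u b → suc (u + u) * b ≡ (u + u) * b + b
    expand = solve-∀

  odd-* : ∀ w w' → Odd w → Odd w' → Odd (w * w')
  odd-* w w' odd odd' 2∣ww' = odd' (odd-2∣* w w' odd 2∣ww')

  odd-cancel : ∀ e w b → Odd w → 2 ^ e ∣ w * b → 2 ^ e ∣ b
  odd-cancel zero w b odd _ = 1∣ b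
  odd-cancel (suc e) w b odd 2^1+e∣wb
    with odd-2∣* w b odd (∣-trans (divides (2 ^ e) (*-comm 2 (2 ^ e))) 2^1+e∣wb)
  ... | divides b' refl = subst (2 ^ suc e ∣_) (*-comm 2 b')
    (*-monoʳ-∣ 2 (odd-cancel e w b' odd (*-cancelˡ-∣ 2 (subst (2 * 2 ^ e ∣_) (regroup w b') 2^1+e∣wb))))
    where
    regroup : ∀ w b' → w * (b' * 2) ≡ 2 * (w * b')
    regroup = solve-∀

  pow∣pow : ∀ {e f} → e ≤ f → 2 ^ e ∣ 2 ^ f
  pow∣pow {e} {f} e≤f = divides (2 ^ (f ∸ e))
    (trans (cong (2 ^_) (sym (m∸n+n≡m e≤f))) (^-distribˡ-+-* 2 (f ∸ e) e))

  pow≤⇒≤ : ∀ {e f} → 2 ^ e ≤ 2 ^ f → e ≤ f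
  pow≤⇒≤ h = ≮⇒≥ (λ f<e → <⇒≱ (^-monoʳ-< 2 (s≤s (s≤s z≤n)) f<e) h)

  pow<⇒< : ∀ {e f} → 2 ^ e < 2 ^ f → e < f
  pow<⇒< h = ≰⇒> (λ f≤e → <⇒≱ h (^-monoʳ-≤ 2 f≤e))

  V2≡⇒odd-part : ∀ {x v} → V2≡ x v → ∃ λ w → x ≡ 2 ^ v * w × Odd w
  V2≡⇒odd-part {v = v} (divides w refl , 2^1+v∤) =
    w , *-comm w (2 ^ v) , λ { (divides r refl) → 2^1+v∤ (divides r (regroup r (2 ^ v))) }
    where
    regroup : ∀ r P → r * 2 * P ≡ r * (2 * P)
    regroup = solve-∀

  odd-part⇒V2≡ : ∀ v w → Odd w → V2≡ (2 ^ v * w) v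
  odd-part⇒V2≡ v w odd = m∣m*n w , λ 2^1+v∣ →
    odd (*-cancelˡ-∣ (2 ^ v) {{m^n≢0 2 v}} (subst (_∣ 2 ^ v * w) (*-comm 2 (2 ^ v)) 2^1+v∣))

  odd-part : ∀ x → ∃₂ λ v w → suc x ≡ 2 ^ v * w × Odd w
  odd-part = <-rec _ step
    where
    step : ∀ x → (∀ {y} → y < x → ∃₂ λ v w → suc y ≡ 2 ^ v * w × Odd w) → ∃₂ λ v w → suc x ≡ 2 ^ v * w × Odd w
    step x rec with double-or-odd x
    ... | inj₁ (u , refl) = 0 , suc (u + u) , sym (+-identityʳ _) , odd-double+1 u
    ... | inj₂ (u , refl) with rec (s≤s (m≤m+n u u))
    ...   | v , w , 1+u≡2^vw , odd = suc v , w , trans (double u) (trans (cong (2 *_) 1+u≡2^vw) (sym (*-assoc 2 (2 ^ v) w))) , odd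
      where
      double : ∀ u → suc (suc (u + u)) ≡ 2 * suc u
      double = solve-∀

  V2≡-odd-* : ∀ {w b e} → Odd w → V2≡ b e → V2≡ (w * b) e
  V2≡-odd-* {w} {e = e} odd vb with V2≡⇒odd-part {v = e} vb
  ... | w' , refl , odd' = subst (λ z → V2≡ z e) (regroup w (2 ^ e) w') (odd-part⇒V2≡ e (w * w') (odd-* w w' odd odd'))
    where
    regroup : ∀ w P w' → P * (w * w') ≡ w * (P * w')
    regroup = solve-∀

  V2≡-odd-*⁻¹ : ∀ {w b e} → Odd w → V2≡ (w * b) e → V2≡ b e
  V2≡-odd-*⁻¹ {w} {b} {e} odd (2^e∣ , 2^1+e∤) = odd-cancel e w b odd 2^e∣ , λ 2^1+e∣ → 2^1+e∤ (∣n⇒∣m*n w 2^1+e∣)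

  V2≡-pow-* : ∀ a {b e} → V2≡ b e → V2≡ (2 ^ a * b) (a + e)
  V2≡-pow-* a {e = e} vb with V2≡⇒odd-part {v = e} vb
  ... | w , refl , odd = subst (λ z → V2≡ z (a + e))
    (trans (cong (_* w) (^-distribˡ-+-* 2 a e)) (*-assoc (2 ^ a) (2 ^ e) w)) (odd-part⇒V2≡ (a + e) w odd)

  V2≡-half : ∀ q e → V2≡ (2 * q) e → ∃ λ e' → e ≡ suc e' × V2≡ q e'
  V2≡-half q zero (_ , 2∤) = contradiction (m∣m*n q) 2∤
  V2≡-half q (suc e) (2^1+e∣ , 2^2+e∤) = e , refl , *-cancelˡ-∣ 2 2^1+e∣ , λ 2^1+e∣q → 2^2+e∤ (*-monoʳ-∣ 2 2^1+e∣q)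

  binom : ℕ → ℕ → ℕ
  binom _ zero = 1
  binom zero (suc i) = 0
  binom (suc K) (suc i) = binom K i + binom K (suc i)

  binom-absorb : ∀ K i → suc i * binom (suc K) (suc i) ≡ suc K * binom K i
  binom-absorb zero zero = refl
  binom-absorb zero (suc i) = *-zeroʳ (suc (suc i))
  binom-absorb (suc K) zero =
    trans (*-identityˡ _) (cong suc (trans (sym (*-identityˡ _)) (binom-absorb K 0)))
  binom-absorb (suc K) (suc i) =
    step (binom K i) (binom K (suc i)) (binom (suc K) (suc (suc i))) (binom-absorb K (suc i)) (binom-absorb K i)
    where
    -- with  a = C(K,i),  b = C(K,i+1),  c = C(K+1,i+2):  C(K+1,i+1) = a + b  and  C(K+2,i+2) = (a + b) + c
    step : ∀ a b c → suc (suc i) * c ≡ suc K * b → suc i * (a + b) ≡ suc K * a →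
           suc (suc i) * ((a + b) + c) ≡ suc (suc K) * (a + b)
    step a b c IH₁ IH₂ = begin
      suc (suc i) * ((a + b) + c)                       ≡⟨ expand i a b c ⟩
      (a + b) + suc i * (a + b) + suc (suc i) * c       ≡⟨ cong₂ (λ u v → (a + b) + u + v) IH₂ IH₁ ⟩
      (a + b) + suc K * a + suc K * b                   ≡⟨ collect K a b ⟩
      suc (suc K) * (a + b)                             ∎
      where
      open ≡-Reasoning
      expand : ∀ i a b c → suc (suc i) * ((a + b) + c) ≡ (a + b) + suc i * (a + b) + suc (suc i) * c
      expand = solve-∀
      collect : ∀ K a b → (a + b) + suc K * a + suc K * b ≡ suc (suc K) * (a + b)
      collect = solve-∀

  binom-absorb-pow : ∀ {m i} t v w → suc m ≡ 2 ^ t → suc i ≡ 2 ^ v * w → v ≤ t →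
    w * binom (suc m) (suc i) ≡ 2 ^ (t ∸ v) * binom m i
  binom-absorb-pow {m} {i} t v w m+1≡2^t i+1≡2^vw v≤t = *-cancelˡ-≡ _ _ (2 ^ v) {{m^n≢0 2 v}} (begin
    2 ^ v * (w * binom (suc m) (suc i))     ≡⟨ *-assoc (2 ^ v) w _ ⟨
    2 ^ v * w * binom (suc m) (suc i)       ≡⟨ cong (_* binom (suc m) (suc i)) i+1≡2^vw ⟨
    suc i * binom (suc m) (suc i)           ≡⟨ binom-absorb m i ⟩
    suc m * binom m i                       ≡⟨ cong (_* binom m i) m+1≡2^t ⟩
    2 ^ t * binom m i                       ≡⟨ cong (λ e → 2 ^ e * binom m i) (m∸n+n≡m v≤t) ⟨
    2 ^ (t ∸ v + v) * binom m i             ≡⟨ cong (_* binom m i) (^-distribˡ-+-* 2 (t ∸ v) v) ⟩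
    2 ^ (t ∸ v) * 2 ^ v * binom m i         ≡⟨ swap (2 ^ (t ∸ v)) (2 ^ v) (binom m i) ⟩
    2 ^ v * (2 ^ (t ∸ v) * binom m i)       ∎)
    where
    open ≡-Reasoning
    swap : ∀ a b c → a * b * c ≡ b * (a * c)
    swap = solve-∀

  pow-part≤ : ∀ {x v w} → suc x ≡ 2 ^ v * w → 2 ^ v ≤ suc x
  pow-part≤ {v = v} {w} x+1≡2^vw = ∣⇒≤ (subst (2 ^ v ∣_) (sym x+1≡2^vw) (m∣m*n w))

  binom-pow-pred-odd : ∀ t {m} → suc m ≡ 2 ^ t → ∀ j → j ≤ m → Odd (binom m j)
  binom-pow-pred-odd t m+1≡2^t zero _ = λ 2∣1 → contradiction (∣1⇒≡1 2∣1) λ ()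
  binom-pow-pred-odd t {m} m+1≡2^t (suc j) j<m 2∣next with odd-part j
  ... | v , w , j+1≡2^vw , odd-w = binom-pow-pred-odd t m+1≡2^t j (≤-trans (n≤1+n j) j<m) 2∣current
    where
    v<t : v < t
    v<t = pow<⇒< {v} {t} (≤-trans (s≤s (pow-part≤ {v = v} j+1≡2^vw))
                          (≤-trans (s≤s j<m) (≤-reflexive m+1≡2^t)))
    -- C(2^t, j+1) = C(m, j) + C(m, j+1) is even because t - v ≥ 1
    2∣whole : 2 ∣ binom (suc m) (suc j)
    2∣whole = odd-2∣* w _ odd-w (subst (2 ∣_) (sym (binom-absorb-pow t v w m+1≡2^t j+1≡2^vw (<⇒≤ v<t)))
      (∣-trans (pow∣pow {1} {t ∸ v} (m<n⇒0<n∸m v<t)) (m∣m*n _)))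
    2∣current : 2 ∣ binom m j
    2∣current = ∣m+n∣m⇒∣n (subst (2 ∣_) (+-comm (binom m j) _) 2∣whole) 2∣next

  binom-pow-valuation : ∀ t {m} → suc m ≡ 2 ^ t → ∀ i v → i ≤ m → V2≡ (suc i) v →
    v ≤ t × V2≡ (binom (suc m) (suc i)) (t ∸ v)
  binom-pow-valuation t {m} m+1≡2^t i v i≤m vi with V2≡⇒odd-part {v = v} vi
  ... | w , i+1≡2^vw , odd-w = v≤t , V2≡-odd-*⁻¹ {e = t ∸ v} odd-w
    (subst (λ x → V2≡ x (t ∸ v)) (sym (binom-absorb-pow t v w m+1≡2^t i+1≡2^vw v≤t))
      (odd-part⇒V2≡ (t ∸ v) (binom m i) (binom-pow-pred-odd t m+1≡2^t i i≤m)))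
    where
    v≤t : v ≤ t
    v≤t = pow≤⇒≤ {v} {t} (≤-trans (pow-part≤ {v = v} i+1≡2^vw)
                          (≤-trans (s≤s i≤m) (≤-reflexive m+1≡2^t)))

module PowerSeries where

  open import Data.Nat as ℕ using (ℕ; zero; suc; _<_; _∸_; _^_)
  import Data.Nat.Properties as ℕₚ
  open import Data.Integer using (ℤ; +_; -_; _+_; _*_; _-_)
  import Data.Integer.Properties as ℤₚ
  open import Data.Integer.Tactic.RingSolver using (solve-∀)
  open import Relation.Binary.PropositionalEquality
  open import Relation.Binary.Bundles using (Setoid)
  import Relation.Binary.Reasoning.Setoid as SetoidReasoning

  Series : Set
  Series = ℕ → ℤ

  module ≗-Reasoning = SetoidReasoning (ℕ →-setoid ℤ)

  one : Series
  one zero = + 1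
  one (suc _) = + 0

  shift : Series → Series
  shift f zero = + 0
  shift f (suc k) = f k

  infixr 6 ⟨1+_t⟩_
  ⟨1+_t⟩_ : ℤ → Series → Series
  (⟨1+ a t⟩ f) k = f k + a * shift f k

  prod : ℕ → (ℕ → ℤ) → Series → Series
  prod zero c f = f
  prod (suc m) c f = ⟨1+ c m t⟩ prod m c f

  prod₂ : ℕ → (ℕ → ℤ) → (ℕ → ℤ) → Series → Series
  prod₂ zero a b f = f
  prod₂ (suc m) a b f = ⟨1+ a m t⟩ ⟨1+ b m t⟩ prod₂ m a b f

  shift-cong : ∀ {f g} → f ≗ g → shift f ≗ shift g
  shift-cong f≗g zero = refl
  shift-cong f≗g (suc k) = f≗g k

  lin-cong : ∀ a {f g} → f ≗ g → ⟨1+ a t⟩ f ≗ ⟨1+ a t⟩ g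
  lin-cong a f≗g k = cong₂ (λ x y → x + a * y) (f≗g k) (shift-cong f≗g k)

  lin-zero : ∀ f → ⟨1+ + 0 t⟩ f ≗ f
  lin-zero f k = ℤₚ.+-identityʳ (f k)

  lin-comm : ∀ a b f → ⟨1+ a t⟩ ⟨1+ b t⟩ f ≗ ⟨1+ b t⟩ ⟨1+ a t⟩ f
  lin-comm a b f zero = swap a b (f 0)
    where
    swap : ∀ a b x → (x + b * + 0) + a * + 0 ≡ (x + a * + 0) + b * + 0
    swap = solve-∀
  lin-comm a b f (suc k) = swap a b (f (suc k)) (f k) (shift f k)
    where
    swap : ∀ a b x y z → (x + b * y) + a * (y + b * z) ≡ (x + a * y) + b * (y + a * z)
    swap = solve-∀

  prod-cong : ∀ m c {f g} → f ≗ g → prod m c f ≗ prod m c g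
  prod-cong zero c f≗g = f≗g
  prod-cong (suc m) c f≗g = lin-cong (c m) (prod-cong m c f≗g)

  prod-cong-coeffs : ∀ m {c d} f → (∀ j → j < m → c j ≡ d j) → prod m c f ≗ prod m d f
  prod-cong-coeffs zero f c≡d = λ _ → refl
  prod-cong-coeffs (suc m) {c} {d} f c≡d k =
    trans (lin-cong (c m) (prod-cong-coeffs m f (λ j j<m → c≡d j (ℕₚ.m<n⇒m<1+n j<m))) k)
          (cong (λ x → prod m d f k + x * shift (prod m d f) k) (c≡d m (ℕₚ.n<1+n m)))

  prod-length : ∀ {m m'} c f → m ≡ m' → prod m c f ≗ prod m' c f
  prod-length c f refl _ = refl

  lin-prod : ∀ a m c f → ⟨1+ a t⟩ prod m c f ≗ prod m c (⟨1+ a t⟩ f)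
  lin-prod a zero c f _ = refl
  lin-prod a (suc m) c f = begin
    ⟨1+ a t⟩ ⟨1+ c m t⟩ prod m c f  ≈⟨ lin-comm a (c m) (prod m c f) ⟩
    ⟨1+ c m t⟩ ⟨1+ a t⟩ prod m c f  ≈⟨ lin-cong (c m) (lin-prod a m c f) ⟩
    ⟨1+ c m t⟩ prod m c (⟨1+ a t⟩ f) ∎
    where open ≗-Reasoning

  prod-split : ∀ m' m c f → prod (m' ℕ.+ m) c f ≗ prod m' (λ j → c (j ℕ.+ m)) (prod m c f)
  prod-split zero m c f _ = refl
  prod-split (suc m') m c f = lin-cong (c (m' ℕ.+ m)) (prod-split m' m c f)

  prod-peel : ∀ m c f → prod (suc m) c f ≗ prod m (λ j → c (suc j)) (⟨1+ c 0 t⟩ f)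
  prod-peel zero c f _ = refl
  prod-peel (suc m) c f = lin-cong (c (suc m)) (prod-peel m c f)

  prod-reverse : ∀ m c f → prod m c f ≗ prod m (λ j → c (m ∸ suc j)) f
  prod-reverse zero c f _ = refl
  prod-reverse (suc m) c f = begin
    ⟨1+ c m t⟩ prod m c f                                 ≈⟨ lin-cong (c m) (prod-reverse m c f) ⟩
    ⟨1+ c m t⟩ prod m (λ j → c (m ∸ suc j)) f             ≈⟨ lin-prod (c m) m (λ j → c (m ∸ suc j)) f ⟩
    prod m (λ j → c (m ∸ suc j)) (⟨1+ c m t⟩ f)          ≈⟨ prod-peel m (λ j → c (suc m ∸ suc j)) f ⟨
    prod (suc m) (λ j → c (suc m ∸ suc j)) f              ∎
    where open ≗-Reasoning

  prod₂-prod : ∀ m a b f → prod₂ m a b f ≗ prod m a (prod m b f)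
  prod₂-prod zero a b f _ = refl
  prod₂-prod (suc m) a b f = begin
    ⟨1+ a m t⟩ ⟨1+ b m t⟩ prod₂ m a b f         ≈⟨ lin-cong (a m) (lin-cong (b m) (prod₂-prod m a b f)) ⟩
    ⟨1+ a m t⟩ ⟨1+ b m t⟩ prod m a (prod m b f) ≈⟨ lin-cong (a m) (lin-prod (b m) m a (prod m b f)) ⟩
    ⟨1+ a m t⟩ prod m a (⟨1+ b m t⟩ prod m b f) ∎
    where open ≗-Reasoning

  -- Pairing the factor j with the factor 2M - j, where M = m + 1:
  --   ∏_{j < 2M} (1 + c(j) t) = (1 + c(M) t)(1 + c(0) t) ∏_{1 ≤ j < M} (1 + c(2M - j) t)(1 + c(j) t).
  pairing : ∀ m c f → prod (suc m ℕ.+ suc m) c f ≗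
    ⟨1+ c (suc m) t⟩ ⟨1+ c 0 t⟩ prod₂ m (λ j → c (suc (m ∸ suc j) ℕ.+ suc m)) (λ j → c (suc j)) f
  pairing m c f = begin
    prod (M ℕ.+ M) c f                                   ≈⟨ prod-split M M c f ⟩
    prod M upper (prod M c f)                            ≈⟨ prod-cong M upper (prod-peel m c f) ⟩
    prod M upper X                                       ≈⟨ prod-peel m upper X ⟩
    prod m (λ j → upper (suc j)) (⟨1+ c M t⟩ X)          ≈⟨ prod-reverse m (λ j → upper (suc j)) (⟨1+ c M t⟩ X) ⟩
    prod m b (⟨1+ c M t⟩ X)                              ≈⟨ prod-cong m b (lin-cong (c M) (lin-prod (c 0) m a f)) ⟨
    prod m b (⟨1+ c M t⟩ ⟨1+ c 0 t⟩ prod m a f)          ≈⟨ lin-prod (c M) m b (⟨1+ c 0 t⟩ prod m a f) ⟨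
    ⟨1+ c M t⟩ prod m b (⟨1+ c 0 t⟩ prod m a f)          ≈⟨ lin-cong (c M) (lin-prod (c 0) m b (prod m a f)) ⟨
    ⟨1+ c M t⟩ ⟨1+ c 0 t⟩ prod m b (prod m a f)          ≈⟨ lin-cong (c M) (lin-cong (c 0) (prod₂-prod m b a f)) ⟨
    ⟨1+ c M t⟩ ⟨1+ c 0 t⟩ prod₂ m b a f                  ∎
    where
    open ≗-Reasoning
    M = suc m
    upper = λ j → c (j ℕ.+ M)
    a = λ j → c (suc j)
    b = λ j → c (suc (m ∸ suc j) ℕ.+ M)
    X = prod m a (⟨1+ c 0 t⟩ f)

  -- Congruence of integers modulo Q, with an explicit quotient so that the
  -- ring solver can verify the defining equation.
  infix 4 _≡_mod_ _≋_mod_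
  record _≡_mod_ (x y Q : ℤ) : Set where
    constructor witness
    field
      quotient : ℤ
      equation : x ≡ y + quotient * Q

  _≋_mod_ : Series → Series → ℤ → Set
  _≋_mod_ f g Q = ∀ k → f k ≡ g k mod Q

  ≡⇒≡-mod : ∀ {Q x y} → x ≡ y → x ≡ y mod Q
  ≡⇒≡-mod {Q} {x} refl = witness (+ 0) (add-zero x Q)
    where
    add-zero : ∀ x Q → x ≡ x + + 0 * Q
    add-zero = solve-∀

  mod-refl : ∀ {Q x} → x ≡ x mod Q
  mod-refl = ≡⇒≡-mod refl

  mod-trans : ∀ {Q x y z} → x ≡ y mod Q → y ≡ z mod Q → x ≡ z mod Q
  mod-trans {Q} {z = z} (witness c refl) (witness d refl) = witness (d + c) (regroup z c d Q)
    where
    regroup : ∀ z c d Q → (z + d * Q) + c * Q ≡ z + (d + c) * Q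
    regroup = solve-∀

  mod-sym : ∀ {Q x y} → x ≡ y mod Q → y ≡ x mod Q
  mod-sym {Q} {y = y} (witness c refl) = witness (- c) (cancel y c Q)
    where
    cancel : ∀ y c Q → y ≡ (y + c * Q) + (- c) * Q
    cancel = solve-∀

  mod-+ : ∀ {Q x y x' y'} → x ≡ y mod Q → x' ≡ y' mod Q → x + x' ≡ y + y' mod Q
  mod-+ {Q} {y = y} {y' = y'} (witness c refl) (witness d refl) = witness (c + d) (regroup y y' c d Q)
    where
    regroup : ∀ y y' c d Q → (y + c * Q) + (y' + d * Q) ≡ (y + y') + (c + d) * Q
    regroup = solve-∀

  mod-* : ∀ {Q a b x y} → a ≡ b mod Q → x ≡ y mod Q → a * x ≡ b * y mod Q
  mod-* {Q} {b = b} {y = y} (witness c refl) (witness d refl) =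
    witness (c * y + b * d + c * d * Q) (expand b y c d Q)
    where
    expand : ∀ b y c d Q → (b + c * Q) * (y + d * Q) ≡ b * y + (c * y + b * d + c * d * Q) * Q
    expand = solve-∀

  mod-≡ˡ : ∀ {Q x x' y} → x ≡ x' → x' ≡ y mod Q → x ≡ y mod Q
  mod-≡ˡ refl x≡y = x≡y

  mod-≡ʳ : ∀ {Q x y y'} → y ≡ y' → x ≡ y mod Q → x ≡ y' mod Q
  mod-≡ʳ refl x≡y = x≡y

  ≗⇒≋ : ∀ {Q f g} → f ≗ g → f ≋ g mod Q
  ≗⇒≋ f≗g k = ≡⇒≡-mod (f≗g k)

  ≋-setoid : ℤ → Setoid _ _
  ≋-setoid Q = record
    { Carrier = Series
    ; _≈_ = λ f g → f ≋ g mod Q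
    ; isEquivalence = record
      { refl = λ _ → mod-refl
      ; sym = λ f≋g k → mod-sym (f≋g k)
      ; trans = λ f≋g g≋h k → mod-trans (f≋g k) (g≋h k)
      }
    }

  module ≋-Reasoning (Q : ℤ) = SetoidReasoning (≋-setoid Q)

  lin-mod : ∀ {Q a b f g} → a ≡ b mod Q → f ≋ g mod Q → ⟨1+ a t⟩ f ≋ ⟨1+ b t⟩ g mod Q
  lin-mod a≡b f≋g zero = mod-+ (f≋g 0) (mod-* a≡b mod-refl)
  lin-mod a≡b f≋g (suc k) = mod-+ (f≋g (suc k)) (mod-* a≡b (f≋g k))

  prod₂-mod : ∀ {Q} m {a a' b b' f g} → (∀ j → j < m → a j ≡ a' j mod Q) →
    (∀ j → j < m → b j ≡ b' j mod Q) → f ≋ g mod Q → prod₂ m a b f ≋ prod₂ m a' b' g mod Q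
  prod₂-mod zero a≡a' b≡b' f≋g = f≋g
  prod₂-mod (suc m) a≡a' b≡b' f≋g =
    lin-mod (a≡a' m (ℕₚ.n<1+n m)) (lin-mod (b≡b' m (ℕₚ.n<1+n m))
      (prod₂-mod m (λ j j<m → a≡a' j (ℕₚ.m<n⇒m<1+n j<m)) (λ j j<m → b≡b' j (ℕₚ.m<n⇒m<1+n j<m)) f≋g))

  sum : ℕ → (ℕ → ℤ) → ℤ
  sum zero φ = + 0
  sum (suc n) φ = sum n φ + φ n

  sum-cong : ∀ n {φ ψ} → (∀ i → i < n → φ i ≡ ψ i) → sum n φ ≡ sum n ψ
  sum-cong zero φ≡ψ = refl
  sum-cong (suc n) φ≡ψ = cong₂ _+_ (sum-cong n (λ i i<n → φ≡ψ i (ℕₚ.m<n⇒m<1+n i<n))) (φ≡ψ n (ℕₚ.n<1+n n))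

  sum-zero : ∀ n → sum n (λ _ → + 0) ≡ + 0
  sum-zero zero = refl
  sum-zero (suc n) = cong (_+ + 0) (sum-zero n)

  sum-peel : ∀ n φ → sum (suc n) φ ≡ φ 0 + sum n (λ i → φ (suc i))
  sum-peel zero φ = ℤₚ.+-comm (+ 0) (φ 0)
  sum-peel (suc n) φ = trans (cong (_+ φ (suc n)) (sum-peel n φ))
    (ℤₚ.+-assoc (φ 0) (sum n (λ i → φ (suc i))) (φ (suc n)))

  sum-reverse : ∀ n φ → sum n φ ≡ sum n (λ i → φ (n ∸ suc i))
  sum-reverse zero φ = refl
  sum-reverse (suc n) φ = trans (cong (_+ φ n) (sum-reverse n φ))
    (trans (ℤₚ.+-comm (sum n (λ i → φ (n ∸ suc i))) (φ n))
           (sym (sum-peel n (λ i → φ (suc n ∸ suc i)))))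

  sum-+ : ∀ n φ ψ → sum n (λ i → φ i + ψ i) ≡ sum n φ + sum n ψ
  sum-+ zero φ ψ = refl
  sum-+ (suc n) φ ψ = trans (cong (_+ (φ n + ψ n)) (sum-+ n φ ψ)) (regroup (sum n φ) (sum n ψ) (φ n) (ψ n))
    where
    regroup : ∀ a b c d → (a + b) + (c + d) ≡ (a + c) + (b + d)
    regroup = solve-∀

  sum-*ʳ : ∀ n φ Q → sum n (λ i → φ i * Q) ≡ sum n φ * Q
  sum-*ʳ zero φ Q = refl
  sum-*ʳ (suc n) φ Q = trans (cong (_+ φ n * Q) (sum-*ʳ n φ Q)) (sym (ℤₚ.*-distribʳ-+ Q (sum n φ) (φ n)))

  _⊛_ : Series → Series → Series
  (f ⊛ g) k = sum (suc k) (λ i → f i * g (k ∸ i))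

  ⊛-cong : ∀ {f f' g g'} → f ≗ f' → g ≗ g' → f ⊛ g ≗ f' ⊛ g'
  ⊛-cong f≗f' g≗g' k = sum-cong (suc k) (λ i _ → cong₂ _*_ (f≗f' i) (g≗g' (k ∸ i)))

  ⊛-comm : ∀ f g → f ⊛ g ≗ g ⊛ f
  ⊛-comm f g k = trans (sum-reverse (suc k) (λ i → f i * g (k ∸ i)))
    (sum-cong (suc k) (λ i i≤k → trans (cong (λ j → f (k ∸ i) * g j) (ℕₚ.m∸[m∸n]≡n (ℕₚ.≤-pred i≤k)))
       (ℤₚ.*-comm (f (k ∸ i)) (g i))))

  ⊛-identityˡ : ∀ g → one ⊛ g ≗ g
  ⊛-identityˡ g k = trans (sum-peel k (λ i → one i * g (k ∸ i)))
    (trans (cong₂ _+_ (ℤₚ.*-identityˡ (g k)) (sum-zero k)) (ℤₚ.+-identityʳ (g k)))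

  ⊛-shiftˡ : ∀ f g → shift f ⊛ g ≗ shift (f ⊛ g)
  ⊛-shiftˡ f g zero = refl
  ⊛-shiftˡ f g (suc k) = trans (sum-peel (suc k) (λ i → shift f i * g (suc k ∸ i)))
    (ℤₚ.+-identityˡ ((f ⊛ g) k))

  ⊛-+ˡ : ∀ f f' g → (λ i → f i + f' i) ⊛ g ≗ λ k → (f ⊛ g) k + (f' ⊛ g) k
  ⊛-+ˡ f f' g k = trans (sum-cong (suc k) (λ i _ → ℤₚ.*-distribʳ-+ (g (k ∸ i)) (f i) (f' i)))
    (sum-+ (suc k) (λ i → f i * g (k ∸ i)) (λ i → f' i * g (k ∸ i)))

  ⊛-*ˡ : ∀ h Q g → (λ i → h i * Q) ⊛ g ≗ λ k → (h ⊛ g) k * Q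
  ⊛-*ˡ h Q g k = trans (sum-cong (suc k) (λ i _ → swap (h i) Q (g (k ∸ i))))
    (sum-*ʳ (suc k) (λ i → h i * g (k ∸ i)) Q)
    where
    swap : ∀ a Q b → (a * Q) * b ≡ (a * b) * Q
    swap = solve-∀

  ⊛-linˡ : ∀ a f g → (⟨1+ a t⟩ f) ⊛ g ≗ ⟨1+ a t⟩ (f ⊛ g)
  ⊛-linˡ a f g k = trans (⊛-+ˡ f (λ i → a * shift f i) g k) (cong (λ x → (f ⊛ g) k + x) a-part)
    where
    a-part : ((λ i → a * shift f i) ⊛ g) k ≡ a * shift (f ⊛ g) k
    a-part = trans (⊛-cong {g = g} (λ i → ℤₚ.*-comm a (shift f i)) (λ _ → refl) k)
      (trans (⊛-*ˡ (shift f) a g k) (trans (ℤₚ.*-comm _ a) (cong (a *_) (⊛-shiftˡ f g k))))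

  ⊛-prodˡ : ∀ m c f g → prod m c (f ⊛ g) ≗ prod m c f ⊛ g
  ⊛-prodˡ zero c f g _ = refl
  ⊛-prodˡ (suc m) c f g = begin
    ⟨1+ c m t⟩ prod m c (f ⊛ g)   ≈⟨ lin-cong (c m) (⊛-prodˡ m c f g) ⟩
    ⟨1+ c m t⟩ (prod m c f ⊛ g)   ≈⟨ ⊛-linˡ (c m) (prod m c f) g ⟨
    (⟨1+ c m t⟩ prod m c f) ⊛ g   ∎
    where open ≗-Reasoning

  prod-⊛ : ∀ m c m' d → prod m c (prod m' d one) ≗ prod m c one ⊛ prod m' d one
  prod-⊛ m c m' d = begin
    prod m c (prod m' d one)          ≈⟨ prod-cong m c (⊛-identityˡ (prod m' d one)) ⟨
    prod m c (one ⊛ prod m' d one)    ≈⟨ ⊛-prodˡ m c one (prod m' d one) ⟩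
    prod m c one ⊛ prod m' d one      ∎
    where open ≗-Reasoning

  -- Squaring improves a congruence modulo an even number 2P to one modulo 4P:
  -- (g + 2P h)² = g² + 4P (g h + P h²).
  square-mod : ∀ P f g → f ≋ g mod (+ 2 * P) → f ⊛ f ≋ g ⊛ g mod (+ 2 * (+ 2 * P))
  square-mod P f g f≡g k = witness (gh + hh * P) (trans expand-f (regroup ((g ⊛ g) k)))
    where
    Q = + 2 * P
    h : Series
    h i = _≡_mod_.quotient (f≡g i)
    f' : Series
    f' i = g i + h i * Q
    f≗f' : f ≗ f'
    f≗f' i = _≡_mod_.equation (f≡g i)
    gh = (h ⊛ g) k
    hh = (h ⊛ h) k
    g⊛f' : (g ⊛ f') k ≡ (g ⊛ g) k + gh * Q
    g⊛f' = trans (⊛-comm g f' k) (trans (⊛-+ˡ g (λ i → h i * Q) g k)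
             (cong (λ x → (g ⊛ g) k + x) (⊛-*ˡ h Q g k)))
    h⊛f' : (h ⊛ f') k ≡ gh + hh * Q
    h⊛f' = trans (⊛-comm h f' k) (trans (⊛-+ˡ g (λ i → h i * Q) h k)
             (cong₂ _+_ (⊛-comm g h k) (⊛-*ˡ h Q h k)))
    expand-f : (f ⊛ f) k ≡ ((g ⊛ g) k + gh * Q) + (gh + hh * Q) * Q
    expand-f = trans (⊛-cong f≗f' f≗f' k)
      (trans (⊛-+ˡ g (λ i → h i * Q) f' k)
      (cong₂ _+_ g⊛f' (trans (⊛-*ˡ h Q f' k) (cong (_* Q) h⊛f'))))
    regroup : ∀ x → (x + gh * Q) + (gh + hh * Q) * Q ≡ x + (gh + hh * P) * (+ 2 * Q)
    regroup x = lemma x gh hh P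
      where
      lemma : ∀ a b d P → (a + b * (+ 2 * P)) + (b + d * (+ 2 * P)) * (+ 2 * P)
             ≡ a + (b + d * P) * (+ 2 * (+ 2 * P))
      lemma = solve-∀

  quadratic-factor : ∀ p q F k →
    (⟨1+ p t⟩ ⟨1+ q t⟩ F) k ≡ F k + (p + q) * shift F k + (p * q) * shift (shift F) k
  quadratic-factor p q F zero = expand p q (F 0)
    where
    expand : ∀ p q x → (x + q * + 0) + p * + 0 ≡ x + (p + q) * + 0 + (p * q) * + 0
    expand = solve-∀
  quadratic-factor p q F (suc k) = expand p q (F (suc k)) (F k) (shift F k)
    where
    expand : ∀ p q x y z → (x + q * y) + p * (y + q * z) ≡ x + (p + q) * y + (p * q) * z
    expand = solve-∀

  -- The two coefficient computations behind interleave-step: modulo M², a term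
  -- 2M·x with x ≡ 2nM·g vanishes, and M² - A² acts as -A².
  even-combination : ∀ {M A n x₁ x₂ x₃ g₁ g} →
    x₁ ≡ g₁ mod (M * M) → x₂ ≡ + 2 * n * M * g mod (M * M) → x₃ ≡ g mod (M * M) →
    x₁ + (M + M) * x₂ + (M * M - A * A) * x₃ ≡ g₁ + (- (A * A)) * g mod (M * M)
  even-combination {M} {A} {n} {g₁ = g₁} {g} (witness c₁ refl) (witness c₂ refl) (witness c₃ refl) =
    witness (c₁ + + 4 * n * g + + 2 * M * c₂ + g + (M * M - A * A) * c₃) (regroup g₁ g c₁ c₂ c₃ M A n)
    where
    regroup : ∀ g₁ g c₁ c₂ c₃ M A n →
      (g₁ + c₁ * (M * M)) + (M + M) * (+ 2 * n * M * g + c₂ * (M * M)) + (M * M - A * A) * (g + c₃ * (M * M))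
      ≡ (g₁ + (- (A * A)) * g) + (c₁ + + 4 * n * g + + 2 * M * c₂ + g + (M * M - A * A) * c₃) * (M * M)
    regroup = solve-∀

  odd-combination : ∀ {M A m i x₁ x₂ x₃ g₁ g} →
    x₁ ≡ + 2 * (m - i) * M * g₁ mod (M * M) → x₂ ≡ g₁ mod (M * M) →
    x₃ ≡ + 2 * ((+ 1 + m) - i) * M * g mod (M * M) →
    x₁ + (M + M) * x₂ + (M * M - A * A) * x₃ ≡ + 2 * ((+ 1 + m) - i) * M * (g₁ + (- (A * A)) * g) mod (M * M)
  odd-combination {M} {A} {m} {i} {g₁ = g₁} {g} (witness c₁ refl) (witness c₂ refl) (witness c₃ refl) =
    witness (c₁ + + 2 * M * c₂ + + 2 * ((+ 1 + m) - i) * M * g + (M * M - A * A) * c₃) (regroup g₁ g c₁ c₂ c₃ M A m i)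
    where
    regroup : ∀ g₁ g c₁ c₂ c₃ M A m i →
      (+ 2 * (m - i) * M * g₁ + c₁ * (M * M)) + (M + M) * (g₁ + c₂ * (M * M))
        + (M * M - A * A) * (+ 2 * ((+ 1 + m) - i) * M * g + c₃ * (M * M))
      ≡ + 2 * ((+ 1 + m) - i) * M * (g₁ + (- (A * A)) * g)
        + (c₁ + + 2 * M * c₂ + + 2 * ((+ 1 + m) - i) * M * g + (M * M - A * A) * c₃) * (M * M)
    regroup = solve-∀

  record Interleaved (M : ℤ) (m : ℕ) (F G : Series) : Set where
    field
      even : ∀ i → F (i ℕ.+ i) ≡ G i mod (M * M)
      odd  : ∀ i → F (suc (i ℕ.+ i)) ≡ + 2 * (+ m - + i) * M * G i mod (M * M)

    shifted-odd : ∀ i → shift F (i ℕ.+ i) ≡ + 2 * ((+ 1 + + m) - + i) * M * shift G i mod (M * M)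
    shifted-odd zero = witness (+ 0) (zero-form (+ m) M)
      where
      zero-form : ∀ m M → + 0 ≡ + 2 * ((+ 1 + m) - + 0) * M * + 0 + + 0 * (M * M)
      zero-form = solve-∀
    shifted-odd (suc i) =
      subst (λ j → F j ≡ + 2 * ((+ 1 + + m) - + suc i) * M * G i mod (M * M)) (sym (ℕₚ.+-suc i i))
        (mod-≡ʳ (same-coefficient (+ m) (+ i) M (G i)) (odd i))
      where
      same-coefficient : ∀ m i M g → + 2 * (m - i) * M * g ≡ + 2 * ((+ 1 + m) - (+ 1 + i)) * M * g
      same-coefficient = solve-∀

    shifted-even : ∀ i → shift (shift F) (i ℕ.+ i) ≡ shift G i mod (M * M)
    shifted-even zero = mod-refl
    shifted-even (suc i) = subst (λ j → shift F j ≡ G i mod (M * M)) (sym (ℕₚ.+-suc i i)) (even i)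

  -- With p + q = 2M and pq = M² - A², the factor (1 + p t)(1 + q t) ≡ 1 + 2M t - A² t²
  -- acts on an interleaved pair as (1 - A² u) acts on G, where u = t².
  interleave-step : ∀ {M m F G} p q A → p + q ≡ M + M → p * q ≡ M * M - A * A →
    Interleaved M m F G → Interleaved M (suc m) (⟨1+ p t⟩ ⟨1+ q t⟩ F) (⟨1+ - (A * A) t⟩ G)
  interleave-step {M} {m} {F} p q A p+q pq F/G = record
    { even = λ i → mod-≡ˡ (factor (i ℕ.+ i)) (even-combination {M} {A} {(+ 1 + + m) - + i} (even i) (shifted-odd i) (shifted-even i))
    ; odd  = λ i → mod-≡ˡ (factor (suc (i ℕ.+ i))) (odd-combination {M} {A} {+ m} {+ i} (odd i) (even i) (shifted-odd i))
    }
    where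
    open Interleaved F/G
    factor : ∀ k → (⟨1+ p t⟩ ⟨1+ q t⟩ F) k ≡ F k + (M + M) * shift F k + (M * M - A * A) * shift (shift F) k
    factor k = trans (quadratic-factor p q F k) (cong₂ (λ x y → F k + x * shift F k + y * shift (shift F) k) p+q pq)

  interleave-one : ∀ M → Interleaved M 0 one one
  interleave-one M = record { even = even ; odd = odd }
    where
    even : ∀ i → one (i ℕ.+ i) ≡ one i mod (M * M)
    even zero = mod-refl
    even (suc i) = mod-refl
    odd : ∀ i → one (suc (i ℕ.+ i)) ≡ + 2 * (+ 0 - + i) * M * one i mod (M * M)
    odd zero = witness (+ 0) (vanish M)
      where
      vanish : ∀ M → + 0 ≡ + 2 * (+ 0 - + 0) * M * + 1 + + 0 * (M * M)
      vanish = solve-∀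
    odd (suc i) = witness (+ 0) (vanish (+ 2 * (+ 0 - + suc i) * M) M)
      where
      vanish : ∀ c M → + 0 ≡ c * + 0 + + 0 * (M * M)
      vanish = solve-∀

  interleave-prod : ∀ M m (p q a : ℕ → ℤ) →
    (∀ j → j < m → p j + q j ≡ M + M) → (∀ j → j < m → p j * q j ≡ M * M - a j * a j) →
    Interleaved M m (prod₂ m p q one) (prod m (λ j → - (a j * a j)) one)
  interleave-prod M zero p q a _ _ = interleave-one M
  interleave-prod M (suc m) p q a p+q pq =
    interleave-step (p m) (q m) (a m) (p+q m (ℕₚ.n<1+n m)) (pq m (ℕₚ.n<1+n m))
      (interleave-prod M m p q a (λ j j<m → p+q j (ℕₚ.m<n⇒m<1+n j<m)) (λ j j<m → pq j (ℕₚ.m<n⇒m<1+n j<m)))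

  lin-interleaved-even : ∀ {M m F G} → Interleaved M m F G → ∀ i → (⟨1+ M t⟩ F) (i ℕ.+ i) ≡ G i mod (M * M)
  lin-interleaved-even {M} {m} F/G i = combine {(+ 1 + + m) - + i} (Interleaved.even F/G i) (Interleaved.shifted-odd F/G i)
    where
    combine : ∀ {n x₁ x₂ g₁ g} → x₁ ≡ g₁ mod (M * M) → x₂ ≡ + 2 * n * M * g mod (M * M) → x₁ + M * x₂ ≡ g₁ mod (M * M)
    combine {n} {g₁ = g₁} {g} (witness c₁ refl) (witness c₂ refl) = witness (c₁ + + 2 * n * g + M * c₂) (regroup g₁ g c₁ c₂ M n)
      where
      regroup : ∀ g₁ g c₁ c₂ M n → (g₁ + c₁ * (M * M)) + M * (+ 2 * n * M * g + c₂ * (M * M))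
        ≡ g₁ + (c₁ + + 2 * n * g + M * c₂) * (M * M)
      regroup = solve-∀

  lin-interleaved-odd : ∀ {M m F G} → Interleaved M m F G → ∀ i →
    (⟨1+ M t⟩ F) (suc (i ℕ.+ i)) ≡ M * ((+ 2 * (+ m - + i) + + 1) * G i) mod (M * M)
  lin-interleaved-odd {M} {m} F/G i = combine (Interleaved.odd F/G i) (Interleaved.even F/G i)
    where
    combine : ∀ {x₁ x₂ g} → x₁ ≡ + 2 * (+ m - + i) * M * g mod (M * M) → x₂ ≡ g mod (M * M) →
      x₁ + M * x₂ ≡ M * ((+ 2 * (+ m - + i) + + 1) * g) mod (M * M)
    combine {g = g} (witness c₁ refl) (witness c₂ refl) = witness (c₁ + c₂ * M) (regroup g c₁ c₂ M (+ m) (+ i))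
      where
      regroup : ∀ g c₁ c₂ M m i → (+ 2 * (m - i) * M * g + c₁ * (M * M)) + M * (g + c₂ * (M * M))
        ≡ M * ((+ 2 * (m - i) + + 1) * g) + (c₁ + c₂ * M) * (M * M)
      regroup = solve-∀

  negSquare : ℕ → ℤ
  negSquare a = - (+ a * + a)

  -- the two squares paired by the pairing lemma are congruent: (2P + y)² ≡ (2P - y)² (mod 4P)
  paired-squares : ∀ Y P → - ((Y + + 2 * P) * (Y + + 2 * P)) ≡ - ((+ 2 * P - Y) * (+ 2 * P - Y)) mod (+ 2 * (+ 2 * P))
  paired-squares Y P = witness (- (+ 2 * Y)) (expand Y P)
    where
    expand : ∀ Y P → - ((Y + + 2 * P) * (Y + + 2 * P)) ≡ - ((+ 2 * P - Y) * (+ 2 * P - Y)) + (- (+ 2 * Y)) * (+ 2 * (+ 2 * P))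
    expand = solve-∀

  -- the unpaired factor a = 2P contributes  1 - (2P)² t ≡ 1  (mod 4P)
  middle-square : ∀ P → - ((+ 2 * P) * (+ 2 * P)) ≡ + 0 mod (+ 2 * (+ 2 * P))
  middle-square P = witness (- P) (expand P)
    where
    expand : ∀ P → - ((+ 2 * P) * (+ 2 * P)) ≡ + 0 + (- P) * (+ 2 * (+ 2 * P))
    expand = solve-∀

  squares-double : ∀ m P → + suc m ≡ + 2 * P →
    prod (suc m ℕ.+ suc m) negSquare one ≋ prod (suc m) negSquare one ⊛ prod (suc m) negSquare one mod (+ 2 * (+ 2 * P))
  squares-double m P K≡2P = begin
    prod (suc m ℕ.+ suc m) negSquare one                      ≈⟨ ≗⇒≋ (pairing m negSquare one) ⟩
    ⟨1+ negSquare (suc m) t⟩ ⟨1+ + 0 t⟩ prod₂ m b a one        ≈⟨ pairs≡ ⟩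
    ⟨1+ + 0 t⟩ ⟨1+ + 0 t⟩ prod₂ m a a one                      ≈⟨ ≗⇒≋ drop-units ⟩
    prod₂ m a a one                                           ≈⟨ ≗⇒≋ (prod₂-prod m a a one) ⟩
    prod m a (prod m a one)                                   ≈⟨ ≗⇒≋ (prod-⊛ m a m a) ⟩
    prod m a one ⊛ prod m a one                               ≈⟨ ≗⇒≋ (⊛-cong S≗ S≗) ⟨
    S ⊛ S                                                     ∎
    where
    open ≋-Reasoning (+ 2 * (+ 2 * P))
    S = prod (suc m) negSquare one
    a = λ j → negSquare (suc j)
    b = λ j → negSquare (suc (m ∸ suc j) ℕ.+ suc m)
    S≗ : S ≗ prod m a one
    S≗ k = trans (prod-peel m negSquare one k) (prod-cong m a (lin-zero one) k)
    middle : negSquare (suc m) ≡ + 0 mod (+ 2 * (+ 2 * P))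
    middle = subst (λ K → - (K * K) ≡ + 0 mod (+ 2 * (+ 2 * P))) (sym K≡2P) (middle-square P)
    upper≡lower : ∀ j → j < m → b j ≡ a j mod (+ 2 * (+ 2 * P))
    upper≡lower j j<m = subst₂ (λ u v → - (u * u) ≡ - (v * v) mod (+ 2 * (+ 2 * P))) (sym upper) (sym lower) (paired-squares (+ y) P)
      where
      y = suc (m ∸ suc j)
      y+j≡m : y ℕ.+ suc j ≡ suc m
      y+j≡m = cong suc (ℕₚ.m∸n+n≡m j<m)
      upper : + (y ℕ.+ suc m) ≡ + y + + 2 * P
      upper = trans (ℤₚ.pos-+ y (suc m)) (cong (λ z → + y + z) K≡2P)
      lower : + suc j ≡ + 2 * P - + y
      lower = trans (solve-sub (+ y) (+ suc j)) (cong (_- + y) (trans (sym (ℤₚ.pos-+ y (suc j))) (trans (cong +_ y+j≡m) K≡2P)))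
        where
        solve-sub : ∀ Y J → J ≡ (Y + J) - Y
        solve-sub = solve-∀
    pairs≡ : ⟨1+ negSquare (suc m) t⟩ ⟨1+ + 0 t⟩ prod₂ m b a one ≋ ⟨1+ + 0 t⟩ ⟨1+ + 0 t⟩ prod₂ m a a one
               mod (+ 2 * (+ 2 * P))
    pairs≡ = lin-mod middle (lin-mod {a = + 0} {b = + 0} mod-refl
      (prod₂-mod m upper≡lower (λ _ _ → mod-refl) (λ _ → mod-refl)))
    drop-units : ⟨1+ + 0 t⟩ ⟨1+ + 0 t⟩ prod₂ m a a one ≗ prod₂ m a a one
    drop-units k = trans (lin-zero (⟨1+ + 0 t⟩ prod₂ m a a one) k) (lin-zero (prod₂ m a a one) k)

  -- 2^s as an integer, built so that 2^(s+1) = 2 · 2^s holds by definition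
  pow2ℤ : ℕ → ℤ
  pow2ℤ zero = + 1
  pow2ℤ (suc s) = + 2 * pow2ℤ s

  pow2ℤ≡ : ∀ s → pow2ℤ s ≡ + (2 ^ s)
  pow2ℤ≡ zero = refl
  pow2ℤ≡ (suc s) = trans (cong (+ 2 *_) (pow2ℤ≡ s)) (sym (ℤₚ.pos-* 2 (2 ^ s)))

  pow2-double : ∀ s → 2 ^ suc s ≡ 2 ^ s ℕ.+ 2 ^ s
  pow2-double s = cong (2 ^ s ℕ.+_) (ℕₚ.+-identityʳ (2 ^ s))

  pow2-pred : ∀ s → suc (2 ^ s ∸ 1) ≡ 2 ^ s
  pow2-pred s = ℕₚ.m+[n∸m]≡n {1} {2 ^ s} (ℕₚ.m^n>0 2 s)

  power-double : ∀ n c → prod (n ℕ.+ n) (λ _ → c) one ≗ prod n (λ _ → c) one ⊛ prod n (λ _ → c) one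
  power-double n c = begin
    prod (n ℕ.+ n) (λ _ → c) one                    ≈⟨ prod-split n n (λ _ → c) one ⟩
    prod n (λ _ → c) (prod n (λ _ → c) one)         ≈⟨ prod-⊛ n (λ _ → c) n (λ _ → c) ⟩
    prod n (λ _ → c) one ⊛ prod n (λ _ → c) one     ∎
    where open ≗-Reasoning

  squares-mod : ∀ s → prod (2 ^ suc s) negSquare one ≋ prod (2 ^ s) (λ _ → - + 1) one mod pow2ℤ (suc s)
  squares-mod zero = ≗⇒≋ (lin-cong (- + 1) (lin-zero one))
  squares-mod (suc s) = begin
    prod (2 ^ suc (suc s)) negSquare one     ≈⟨ ≗⇒≋ (prod-length negSquare one (trans (pow2-double (suc s)) (cong₂ ℕ._+_ K≡ K≡))) ⟩
    prod (suc m ℕ.+ suc m) negSquare one     ≈⟨ squares-double m (pow2ℤ s) K≡2P ⟩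
    S ⊛ S                                    ≈⟨ square-mod (pow2ℤ s) S B S≡B ⟩
    B ⊛ B                                    ≈⟨ ≗⇒≋ (power-double (2 ^ s) (- + 1)) ⟨
    prod (2 ^ s ℕ.+ 2 ^ s) (λ _ → - + 1) one ≈⟨ ≗⇒≋ (prod-length (λ _ → - + 1) one (sym (pow2-double s))) ⟩
    prod (2 ^ suc s) (λ _ → - + 1) one       ∎
    where
    open ≋-Reasoning (pow2ℤ (suc (suc s)))
    m = 2 ^ suc s ∸ 1
    K≡ : 2 ^ suc s ≡ suc m
    K≡ = sym (pow2-pred (suc s))
    K≡2P : + suc m ≡ + 2 * pow2ℤ s
    K≡2P = trans (cong +_ (sym K≡)) (sym (pow2ℤ≡ (suc s)))
    S = prod (suc m) negSquare one
    B = prod (2 ^ s) (λ _ → - + 1) one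
    S≡B : S ≋ B mod pow2ℤ (suc s)
    S≡B k = mod-trans (≡⇒≡-mod (prod-length negSquare one (sym K≡) k)) (squares-mod s k)

module StirlingValuations where

  open Valuation using (Odd; binom; pow∣pow; V2≡-odd-*; V2≡-pow-*; binom-pow-valuation)
  open PowerSeries
  open import Data.Nat as ℕ using (ℕ; zero; suc; _<_; _≤_; _∸_; _^_; s≤s)
  import Data.Nat.Properties as ℕₚ
  import Data.Nat.Divisibility as ℕ∣
  open import Data.Integer using (ℤ; +_; -_; _+_; _*_; _-_; ∣_∣)
  import Data.Integer.Properties as ℤₚ
  import Data.Integer.Divisibility.Signed as ℤ∣
  open import Data.Integer.Tactic.RingSolver using (solve-∀)
  open import Data.List using ([]; _∷_)
  open import Data.Product using (_×_; _,_; proj₁; proj₂)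
  open import Relation.Nullary using (contradiction)
  open import Relation.Binary.PropositionalEquality

  coeff-addP : ∀ p q k → coeff (addP p q) k ≡ coeff p k ℕ.+ coeff q k
  coeff-addP [] q k = refl
  coeff-addP (a ∷ p) [] k = sym (ℕₚ.+-identityʳ _)
  coeff-addP (a ∷ p) (b ∷ q) zero = refl
  coeff-addP (a ∷ p) (b ∷ q) (suc k) = coeff-addP p q k

  coeff-scaleP : ∀ c p k → coeff (scaleP c p) k ≡ c ℕ.* coeff p k
  coeff-scaleP c [] k = sym (ℕₚ.*-zeroʳ c)
  coeff-scaleP c (a ∷ p) zero = refl
  coeff-scaleP c (a ∷ p) (suc k) = coeff-scaleP c p k

  stirling1-suc-zero : ∀ N → stirling1 (suc N) 0 ≡ N ℕ.* stirling1 N 0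
  stirling1-suc-zero N = trans (coeff-addP (0 ∷ rising N) (scaleP N (rising N)) 0) (coeff-scaleP N (rising N) 0)

  stirling1-suc-suc : ∀ N j → stirling1 (suc N) (suc j) ≡ stirling1 N j ℕ.+ N ℕ.* stirling1 N (suc j)
  stirling1-suc-suc N j = trans (coeff-addP (0 ∷ rising N) (scaleP N (rising N)) (suc j))
    (cong (stirling1 N j ℕ.+_) (coeff-scaleP N (rising N) (suc j)))

  stirling1-beyond : ∀ N j → N < j → stirling1 N j ≡ 0
  stirling1-beyond zero (suc j) _ = refl
  stirling1-beyond (suc N) (suc j) (s≤s N<j) = begin
    stirling1 (suc N) (suc j)                          ≡⟨ stirling1-suc-suc N j ⟩
    stirling1 N j ℕ.+ N ℕ.* stirling1 N (suc j)        ≡⟨ cong₂ (λ u v → u ℕ.+ N ℕ.* v) (stirling1-beyond N j N<j)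
                                                             (stirling1-beyond N (suc j) (ℕₚ.m<n⇒m<1+n N<j)) ⟩
    N ℕ.* 0                                            ≡⟨ ℕₚ.*-zeroʳ N ⟩
    0                                                  ∎
    where open ≡-Reasoning

  risingRev : ℕ → Series
  risingRev N = prod N +_ one

  risingRev-beyond : ∀ N k → N < k → risingRev N k ≡ + 0
  risingRev-beyond zero (suc k) _ = refl
  risingRev-beyond (suc N) (suc k) (s≤s N<k) =
    trans (cong₂ (λ u v → u + + N * v) (risingRev-beyond N (suc k) (ℕₚ.m<n⇒m<1+n N<k)) (risingRev-beyond N k N<k))
          (trans (ℤₚ.+-identityˡ (+ N * + 0)) (ℤₚ.*-zeroʳ (+ N)))

  pos-step : ∀ {a} b N c → a ≡ b ℕ.+ N ℕ.* c → + a ≡ + b + + N * + c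
  pos-step b N c refl = trans (ℤₚ.pos-+ b (N ℕ.* c)) (cong (λ z → + b + z) (ℤₚ.pos-* N c))

  -- s(N, j) is the coefficient of t^k in ∏_{j<N} (1 + j t) when j + k = N; both sides
  -- satisfy the same recurrence in N
  stirling-coefficient : ∀ N j k → j ℕ.+ k ≡ N → + stirling1 N j ≡ risingRev N k
  stirling-coefficient zero zero zero refl = refl
  stirling-coefficient (suc N) zero k refl = trans (pos-step 0 N _ (stirling1-suc-zero N))
    (cong₂ (λ u v → u + + N * v) (sym (risingRev-beyond N (suc N) (ℕₚ.n<1+n N))) (stirling-coefficient N 0 N refl))
  stirling-coefficient (suc N) (suc j) zero j+1≡N+1 = trans (pos-step _ N _ (stirling1-suc-suc N j))
    (cong₂ (λ u v → u + + N * v) (stirling-coefficient N j 0 j+0≡N) (cong +_ (stirling1-beyond N (suc j) N<j+1)))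
    where
    j+0≡N : j ℕ.+ 0 ≡ N
    j+0≡N = ℕₚ.suc-injective j+1≡N+1
    N<j+1 : N < suc j
    N<j+1 = ℕₚ.≤-reflexive (cong suc (trans (sym j+0≡N) (ℕₚ.+-identityʳ j)))
  stirling-coefficient (suc N) (suc j) (suc k) j+k+2≡N+1 = trans (pos-step _ N _ (stirling1-suc-suc N j))
    (cong₂ (λ u v → u + + N * v) (stirling-coefficient N j (suc k) j+k+1≡N)
      (stirling-coefficient N (suc j) k (trans (sym (ℕₚ.+-suc j k)) j+k+1≡N)))
    where
    j+k+1≡N : j ℕ.+ suc k ≡ N
    j+k+1≡N = ℕₚ.suc-injective j+k+2≡N+1

  stirling-reversed : ∀ N k → k ≤ N → + stirling1 N (N ∸ k) ≡ risingRev N k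
  stirling-reversed N k k≤N = stirling-coefficient N (N ∸ k) k (ℕₚ.m∸n+n≡m k≤N)

  sign : ℕ → ℤ
  sign zero = + 1
  sign (suc i) = - sign i

  binomial-series : ∀ K i → prod K (λ _ → - + 1) one i ≡ sign i * + binom K i
  binomial-series zero zero = refl
  binomial-series zero (suc i) = sym (ℤₚ.*-zeroʳ (sign (suc i)))
  binomial-series (suc K) zero = cong₂ _+_ (binomial-series K zero) (ℤₚ.*-zeroʳ (- + 1))
  binomial-series (suc K) (suc i) = begin
    prod K _ one (suc i) + (- + 1) * prod K _ one i                ≡⟨ cong₂ (λ u v → u + (- + 1) * v) (binomial-series K (suc i)) (binomial-series K i) ⟩
    (- sign i) * + binom K (suc i) + (- + 1) * (sign i * + binom K i) ≡⟨ collect (sign i) (+ binom K i) (+ binom K (suc i)) ⟩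
    (- sign i) * (+ binom K i + + binom K (suc i))                  ≡⟨ cong (- sign i *_) (ℤₚ.pos-+ (binom K i) (binom K (suc i))) ⟨
    (- sign i) * + binom (suc K) (suc i)                            ∎
    where
    open ≡-Reasoning
    collect : ∀ s b₀ b₁ → (- s) * b₁ + (- + 1) * (s * b₀) ≡ (- s) * (b₀ + b₁)
    collect = solve-∀

  binomial-series-abs : ∀ K i → ∣ prod K (λ _ → - + 1) one i ∣ ≡ binom K i
  binomial-series-abs K i = begin
    ∣ prod K (λ _ → - + 1) one i ∣      ≡⟨ cong ∣_∣ (binomial-series K i) ⟩
    ∣ sign i * + binom K i ∣             ≡⟨ ℤₚ.abs-* (sign i) (+ binom K i) ⟩
    ∣ sign i ∣ ℕ.* binom K i             ≡⟨ cong (ℕ._* binom K i) (abs-sign i) ⟩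
    1 ℕ.* binom K i                      ≡⟨ ℕₚ.*-identityˡ (binom K i) ⟩
    binom K i                            ∎
    where
    open ≡-Reasoning
    abs-sign : ∀ i → ∣ sign i ∣ ≡ 1
    abs-sign zero = refl
    abs-sign (suc i) = trans (ℤₚ.∣-i∣≡∣i∣ (sign i)) (abs-sign i)

  V2≡-mod : ∀ {Q x y} e → x ≡ y mod Q → 2 ^ suc e ℕ∣.∣ ∣ Q ∣ → V2≡ ∣ y ∣ e → V2≡ ∣ x ∣ e
  V2≡-mod {Q} {y = y} e (witness c refl) 2^1+e∣Q (2^e∣y , 2^1+e∤y) =
    ℤ∣.∣⇒∣ᵤ {k} {y + c * Q} (ℤ∣.∣m∣n⇒∣m+n (ℤ∣.∣ᵤ⇒∣ {k} {y} 2^e∣y) (ℤ∣.∣n⇒∣m*n c (ℤ∣.∣ᵤ⇒∣ {k} {Q} 2^e∣Q))) ,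
    λ 2^1+e∣x → 2^1+e∤y (ℤ∣.∣⇒∣ᵤ {k'} {y} (ℤ∣.∣m+n∣n⇒∣m (ℤ∣.∣ᵤ⇒∣ {k'} {y + c * Q} 2^1+e∣x) (ℤ∣.∣n⇒∣m*n c (ℤ∣.∣ᵤ⇒∣ {k'} {Q} 2^1+e∣Q))))
    where
    k = + (2 ^ e)
    k' = + (2 ^ suc e)
    2^e∣Q : 2 ^ e ℕ∣.∣ ∣ Q ∣
    2^e∣Q = ℕ∣.∣-trans (pow∣pow (ℕₚ.n≤1+n e)) 2^1+e∣Q

  odd-abs : ∀ z → Odd ∣ + 2 * z + + 1 ∣
  odd-abs z 2∣ = contradiction (ℕ∣.∣1⇒≡1 (ℤ∣.∣⇒∣ᵤ (ℤ∣.∣m+n∣m⇒∣n (ℤ∣.∣ᵤ⇒∣ {+ 2} 2∣) (ℤ∣.∣m⇒∣m*n z (ℤ∣.∣-refl {+ 2}))))) λ ()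

  -- The main computation, for  N = 2^(n₀+2) = 2M  with  M = 2^(n₀+1) = m + 1.
  module Computation (n₀ : ℕ) where

    m : ℕ
    m = 2 ^ suc n₀ ∸ 1

    M≡ : suc m ≡ 2 ^ suc n₀
    M≡ = pow2-pred (suc n₀)

    N : ℕ
    N = 2 ^ suc (suc n₀)

    N≡ : N ≡ suc m ℕ.+ suc m
    N≡ = trans (pow2-double (suc n₀)) (cong₂ ℕ._+_ (sym M≡) (sym M≡))

    Mℤ : ℤ
    Mℤ = + suc m

    -- pairing j + 1 with 2M - (j + 1) writes them as M + y and M - y
    y upper lower : ℕ → ℤ
    y j = + suc (m ∸ suc j)
    upper j = + (suc (m ∸ suc j) ℕ.+ suc m)
    lower j = + suc j

    F G : Series
    F = prod₂ m upper lower one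
    G = prod m (λ j → - (y j * y j)) one

    rising-paired : risingRev N ≗ ⟨1+ Mℤ t⟩ F
    rising-paired k = trans (prod-length +_ one N≡ k) (trans (pairing m +_ one k) (lin-cong Mℤ (lin-zero F) k))

    y+lower : ∀ j → j < m → y j + lower j ≡ Mℤ
    y+lower j j<m = trans (sym (ℤₚ.pos-+ (suc (m ∸ suc j)) (suc j))) (cong (λ z → + suc z) (ℕₚ.m∸n+n≡m j<m))

    pair-sum : ∀ j → j < m → upper j + lower j ≡ Mℤ + Mℤ
    pair-sum j j<m = begin
      upper j + lower j          ≡⟨ cong (_+ lower j) (ℤₚ.pos-+ (suc (m ∸ suc j)) (suc m)) ⟩
      (y j + Mℤ) + lower j       ≡⟨ swap (y j) Mℤ (lower j) ⟩
      (y j + lower j) + Mℤ       ≡⟨ cong (_+ Mℤ) (y+lower j j<m) ⟩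
      Mℤ + Mℤ                    ∎
      where
      open ≡-Reasoning
      swap : ∀ a b c → (a + b) + c ≡ (a + c) + b
      swap = solve-∀

    pair-product : ∀ j → j < m → upper j * lower j ≡ Mℤ * Mℤ - y j * y j
    pair-product j j<m = begin
      upper j * lower j                    ≡⟨ cong (_* lower j) (ℤₚ.pos-+ (suc (m ∸ suc j)) (suc m)) ⟩
      (y j + Mℤ) * lower j                 ≡⟨ cong (λ z → (y j + z) * lower j) (y+lower j j<m) ⟨
      (y j + (y j + lower j)) * lower j    ≡⟨ expand (y j) (lower j) ⟩
      (y j + lower j) * (y j + lower j) - y j * y j  ≡⟨ cong (λ z → z * z - y j * y j) (y+lower j j<m) ⟩
      Mℤ * Mℤ - y j * y j                  ∎
      where
      open ≡-Reasoning
      expand : ∀ a b → (a + (a + b)) * b ≡ (a + b) * (a + b) - a * a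
      expand = solve-∀

    F/G : Interleaved Mℤ m F G
    F/G = interleave-prod Mℤ m upper lower y pair-sum pair-product

    G-squares : G ≗ prod (2 ^ suc n₀) negSquare one
    G-squares = begin
      G                                                ≈⟨ prod-reverse m (λ j → - (y j * y j)) one ⟩
      prod m (λ j → - (y (m ∸ suc j) * y (m ∸ suc j))) one ≈⟨ prod-cong-coeffs m one (λ j j<m → cong (λ z → negSquare (suc z)) (reverse-index j j<m)) ⟩
      prod m (λ j → negSquare (suc j)) one             ≈⟨ prod-cong m _ (lin-zero one) ⟨
      prod m (λ j → negSquare (suc j)) (⟨1+ + 0 t⟩ one) ≈⟨ prod-peel m negSquare one ⟨
      prod (suc m) negSquare one                       ≈⟨ prod-length negSquare one M≡ ⟩
      prod (2 ^ suc n₀) negSquare one                  ∎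
      where
      open ≗-Reasoning
      reverse-index : ∀ j → j < m → m ∸ suc (m ∸ suc j) ≡ j
      reverse-index j j<m = trans (cong (m ∸_) (sym (ℕₚ.+-∸-assoc 1 j<m))) (ℕₚ.m∸[m∸n]≡n (ℕₚ.<⇒≤ j<m))

    G≡binomial : G ≋ prod (2 ^ n₀) (λ _ → - + 1) one mod pow2ℤ (suc n₀)
    G≡binomial k = mod-trans (≡⇒≡-mod (G-squares k)) (squares-mod n₀ k)

    -- v₂ G(q) = n₀ - v₂(q)  for q = i + 1 ≤ 2^n₀, since G(q) ≡ ± C(2^n₀, q) modulo 2^(n₀+1)
    G-valuation : ∀ i e → suc i ≤ 2 ^ n₀ → V2≡ (suc i) e → e ≤ n₀ × V2≡ ∣ G (suc i) ∣ (n₀ ∸ e)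
    G-valuation i e i<2^n₀ vi = proj₁ binom-val , V2≡-mod (n₀ ∸ e) (G≡binomial (suc i)) 2^1+e∣ vB
      where
      binom-val = binom-pow-valuation n₀ (pow2-pred n₀) i e
        (ℕₚ.≤-pred (subst (suc i ≤_) (sym (pow2-pred n₀)) i<2^n₀)) vi
      vB : V2≡ ∣ prod (2 ^ n₀) (λ _ → - + 1) one (suc i) ∣ (n₀ ∸ e)
      vB = subst (λ x → V2≡ x (n₀ ∸ e))
        (sym (trans (binomial-series-abs (2 ^ n₀) (suc i)) (cong (λ K → binom K (suc i)) (sym (pow2-pred n₀)))))
        (proj₂ binom-val)
      2^1+e∣ : 2 ^ suc (n₀ ∸ e) ℕ∣.∣ ∣ pow2ℤ (suc n₀) ∣
      2^1+e∣ = subst (2 ^ suc (n₀ ∸ e) ℕ∣.∣_) (sym (cong ∣_∣ (pow2ℤ≡ (suc n₀)))) (pow∣pow (s≤s (ℕₚ.m∸n≤m n₀ e)))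

    -- M² = 2^(2n₀ + 2)
    pow∣M² : ∀ e → e ≤ suc n₀ ℕ.+ n₀ → 2 ^ suc e ℕ∣.∣ ∣ Mℤ * Mℤ ∣
    pow∣M² e e≤ = subst (2 ^ suc e ℕ∣.∣_) (sym M²≡) (pow∣pow (subst (suc e ≤_) (sym (ℕₚ.+-suc (suc n₀) n₀)) (s≤s e≤)))
      where
      M²≡ : ∣ Mℤ * Mℤ ∣ ≡ 2 ^ (suc n₀ ℕ.+ suc n₀)
      M²≡ = trans (ℤₚ.abs-* Mℤ Mℤ) (trans (cong₂ ℕ._*_ M≡ M≡) (sym (ℕₚ.^-distribˡ-+-* 2 (suc n₀) (suc n₀))))

    odd-index≤N : ∀ i → suc i ≤ 2 ^ n₀ → suc (suc i ℕ.+ suc i) ≤ N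
    odd-index≤N i i≤ = ℕₚ.≤-trans (s≤s (ℕₚ.≤-trans (ℕₚ.+-mono-≤ i≤ i≤) (ℕₚ.≤-reflexive (sym (pow2-double n₀)))))
      (ℕₚ.≤-trans (ℕₚ.+-monoˡ-≤ (2 ^ suc n₀) (ℕₚ.m^n>0 2 (suc n₀))) (ℕₚ.≤-reflexive (sym (pow2-double (suc n₀)))))

    stirling-even : ∀ i e → suc i ≤ 2 ^ n₀ → V2≡ (suc i) e → V2≡ (stirling1 N (N ∸ (suc i ℕ.+ suc i))) (n₀ ∸ e)
    stirling-even i e i≤ vi = subst (λ x → V2≡ x (n₀ ∸ e)) (cong ∣_∣ (sym (stirling-reversed N k k≤N)))
      (V2≡-mod (n₀ ∸ e) coefficient≡ (pow∣M² (n₀ ∸ e) (ℕₚ.≤-trans (ℕₚ.m∸n≤m n₀ e) (ℕₚ.m≤n+m n₀ (suc n₀))))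
        (proj₂ (G-valuation i e i≤ vi)))
      where
      k = suc i ℕ.+ suc i
      k≤N : k ≤ N
      k≤N = ℕₚ.≤-trans (ℕₚ.n≤1+n k) (odd-index≤N i i≤)
      coefficient≡ : risingRev N k ≡ G (suc i) mod (Mℤ * Mℤ)
      coefficient≡ = mod-≡ˡ (rising-paired k) (lin-interleaved-even F/G (suc i))

    stirling-odd : ∀ i e → suc i ≤ 2 ^ n₀ → V2≡ (suc i) e →
      e ≤ n₀ × V2≡ (stirling1 N (N ∸ suc (suc i ℕ.+ suc i))) (suc n₀ ℕ.+ (n₀ ∸ e))
    stirling-odd i e i≤ vi = proj₁ G-val , subst (λ x → V2≡ x exponent) (cong ∣_∣ (sym (stirling-reversed N k (odd-index≤N i i≤))))
      (V2≡-mod exponent coefficient≡ (pow∣M² exponent (ℕₚ.+-monoʳ-≤ (suc n₀) (ℕₚ.m∸n≤m n₀ e))) v-target)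
      where
      k = suc (suc i ℕ.+ suc i)
      exponent = suc n₀ ℕ.+ (n₀ ∸ e)
      G-val = G-valuation i e i≤ vi
      u = + 2 * (+ m - + suc i) + + 1
      coefficient≡ : risingRev N k ≡ Mℤ * (u * G (suc i)) mod (Mℤ * Mℤ)
      coefficient≡ = mod-≡ˡ (rising-paired k) (lin-interleaved-odd F/G (suc i))
      -- M = 2^(n₀+1) times the odd number u times G(i+1)
      v-target : V2≡ ∣ Mℤ * (u * G (suc i)) ∣ exponent
      v-target = subst (λ x → V2≡ x exponent)
        (sym (trans (ℤₚ.abs-* Mℤ (u * G (suc i))) (cong₂ ℕ._*_ M≡ (ℤₚ.abs-* u (G (suc i))))))
        (V2≡-pow-* (suc n₀) {e = n₀ ∸ e} (V2≡-odd-* {e = n₀ ∸ e} (odd-abs (+ m - + suc i)) (proj₂ G-val)))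

open Valuation using (odd⇒double+1; V2≡-half)
open StirlingValuations using (module Computation)
open import Data.Nat using (ℕ; zero; suc; _+_; _*_; _∸_; _^_; _≤_; s≤s)
open import Data.Nat.Properties
open import Data.Nat.Divisibility using (_∣_; divides)
open import Data.Nat.Tactic.RingSolver using (solve-∀)
open import Data.Product using (_×_; _,_)
open import Relation.Nullary using (¬_)
open import Relation.Binary.PropositionalEquality

half-bound : ∀ n₀ q → q + q ≤ 2 ^ suc n₀ + 1 → q ≤ 2 ^ n₀
half-bound n₀ q q+q≤ = ≮⇒≥ λ P<q → 1+n≰n (≤-pred (≤-trans (doubled P<q) (subst (q + q ≤_) (bound≡ P) q+q≤)))
  where
  P = 2 ^ n₀
  doubled : suc P ≤ q → suc (suc (P + P)) ≤ q + q
  doubled P<q = ≤-trans (≤-reflexive (cong suc (sym (+-suc P P)))) (+-mono-≤ P<q P<q)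
  bound≡ : ∀ P → P + (P + 0) + 1 ≡ suc (P + P)
  bound≡ = solve-∀

odd-exponent : ∀ n₀ e' → e' ≤ n₀ → (2 * suc (suc n₀) ∸ 2) ∸ suc e' ≡ suc n₀ + (n₀ ∸ e')
odd-exponent n₀ e' e'≤n₀ =
  trans (cong (_∸ suc e') (two-n n₀)) (trans (cong (_∸ e') (+-suc n₀ n₀)) (+-∸-assoc (suc n₀) e'≤n₀))
  where
  two-n : ∀ n₀ → n₀ + suc (suc (n₀ + 0)) ≡ suc (n₀ + suc n₀)
  two-n = solve-∀

stirling-even-index : ∀ n₀ q e → 2 ≤ q + q → q + q ≤ 2 ^ suc n₀ + 1 → V2≡ q e →
  V2≡ (stirling1 (2 ^ suc (suc n₀)) (2 ^ suc (suc n₀) ∸ (q + q))) (n₀ ∸ e)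
stirling-even-index n₀ zero e () _ _
stirling-even-index n₀ (suc i) e _ q+q≤ vq = Computation.stirling-even n₀ i e (half-bound n₀ (suc i) q+q≤) vq

stirling-odd-index : ∀ n₀ u e → 2 ≤ suc (u + u) → suc (u + u) ≤ 2 ^ suc n₀ + 1 → V2≡ u e →
  e ≤ n₀ × V2≡ (stirling1 (2 ^ suc (suc n₀)) (2 ^ suc (suc n₀) ∸ suc (u + u))) (suc n₀ + (n₀ ∸ e))
stirling-odd-index n₀ zero e (s≤s ()) _ _
stirling-odd-index n₀ (suc i) e _ 2u+1≤ vu =
  Computation.stirling-odd n₀ i e (half-bound n₀ (suc i) (≤-trans (n≤1+n _) 2u+1≤)) vu

corollary1p3 : (n k : ℕ) → 2 ≤ n → 2 ≤ k → k ≤ 2 ^ (n ∸ 1) + 1 →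
    ((2 ∣ k) → (e : ℕ) → V2≡ k e → V2≡ (stirling1 (2 ^ n) (2 ^ n ∸ k)) ((n ∸ 1) ∸ e)) ×
    (¬ (2 ∣ k) → (e : ℕ) → V2≡ (k ∸ 1) e → V2≡ (stirling1 (2 ^ n) (2 ^ n ∸ k)) ((2 * n ∸ 2) ∸ e))
corollary1p3 (suc (suc n₀)) k (s≤s (s≤s _)) 2≤k k≤ = even-case , odd-case
  where
  N = 2 ^ suc (suc n₀)

  -- k = 2q, and v₂(k) = e forces e = e' + 1 with v₂(q) = e'
  even-case : 2 ∣ k → ∀ e → V2≡ k e → V2≡ (stirling1 N (N ∸ k)) (suc n₀ ∸ e)
  even-case (divides q k≡q*2) e vk with V2≡-half q e (subst (λ x → V2≡ x e) (trans k≡q*2 (*-comm q 2)) vk)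
  ... | e' , refl , vq = subst (λ x → V2≡ (stirling1 N (N ∸ x)) (n₀ ∸ e')) (sym k≡q+q)
    (stirling-even-index n₀ q e' (subst (2 ≤_) k≡q+q 2≤k) (subst (_≤ 2 ^ suc n₀ + 1) k≡q+q k≤) vq)
    where
    k≡q+q : k ≡ q + q
    k≡q+q = trans k≡q*2 (trans (*-comm q 2) (cong (q +_) (+-identityʳ q)))

  -- k = 2u + 1, and v₂(k - 1) = e forces e = e' + 1 with v₂(u) = e'
  odd-case : ¬ 2 ∣ k → ∀ e → V2≡ (k ∸ 1) e → V2≡ (stirling1 N (N ∸ k)) ((2 * suc (suc n₀) ∸ 2) ∸ e)
  odd-case k-odd e vk with odd⇒double+1 k k-odd
  ... | u , refl with V2≡-half u e (subst (λ x → V2≡ x e) (cong (u +_) (sym (+-identityʳ u))) vk)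
  ...   | e' , refl , vu with stirling-odd-index n₀ u e' 2≤k k≤ vu
  ...     | e'≤n₀ , v-stirling = subst (V2≡ _) (sym (odd-exponent n₀ e' e'≤n₀)) v-stirling
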